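{- Let $\Gamma,\Delta$ be finite multisets of formulas and let $A$ be either a single formula or empty. If the focused sequent $\Gamma\vdash A;\Delta$ has a proof in the focused classical sequent calculus, then the sequent $\Gamma^p,\lrcorner\Delta^n\vdash A^n$ has a proof in the cut-free intuitionistic sequent calculus, where $\Gamma^p=\{B^p:B\in\Gamma\}$, $\lrcorner\Delta^n=\{\lrcorner(B^n):B\in\Delta\}$, and $A^n$ denotes the empty right-hand side when $A$ is empty.
   Context: Formulas are first-order formulas built from atomic formulas with $\wedge,\vee,\Rightarrow,\neg,\forall,\exists$. Antinegation: for a formula $A$, $\lrcorner A$ is $B$ if $A$ is syntactically $\neg B$, and $\neg A$ otherwise (an operation on formulas, not a connective). Polarized Gödel–Gentzen translations ${}^p$ and ${}^n$, defined simultaneously by induction: for atomic $A$, $A^p=A$ and $A^n=\neg\neg A$; $(A\wedge B)^p=A^p\wedge B^p$, $(A\wedge B)^n=A^n\wedge B^n$; $(A\vee B)^p=A^p\vee B^p$, $(A\vee B)^n=\neg(\neg A^n\wedge\neg B^n)$; $(A\Rightarrow B)^p=A^n\Rightarrow B^p$, $(A\Rightarrow B)^n=A^p\Rightarrow B^n$; $(\neg A)^p=\neg A^n$, $(\neg A)^n=\neg A^p$; $(\forall xA)^p=\forall xA^p$, $(\forall xA)^n=\forall xA^n$; $(\exists xA)^p=\exists xA^p$, $(\exists xA)^n=\neg\forall x\neg A^n$. Cut-free intuitionistic sequent calculus: sequents $\Gamma\vdash\Delta$ with $\Delta$ of at most one formula; axiom $\Gamma,A\vdash A$; $\wedge_L$: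 from $\Gamma,A,B\vdash\Delta$ infer $\Gamma,A\wedge B\vdash\Delta$; $\wedge_R$: from $\Gamma\vdash A$, $\Gamma\vdash B$ infer $\Gamma\vdash A\wedge B$; $\vee_L$: from $\Gamma,A\vdash\Delta$, $\Gamma,B\vdash\Delta$ infer $\Gamma,A\vee B\vdash\Delta$; $\vee_{R1},\vee_{R2}$: from $\Gamma\vdash A$ (resp. $\Gamma\vdash B$) infer $\Gamma\vdash A\vee B$; $\Rightarrow_L$: from $\Gamma\vdash A$ and $\Gamma,B\vdash\Delta$ infer $\Gamma,A\Rightarrow B\vdash\Delta$; $\Rightarrow_R$: from $\Gamma,A\vdash B$ infer $\Gamma\vdash A\Rightarrow B$; $\neg_L$: from $\Gamma\vdash A$ infer $\Gamma,\neg A\vdash\Delta$; $\neg_R$: from $\Gamma,A\vdash$ infer $\Gamma\vdash\neg A$; $\exists_L$: from $\Gamma,A[c/x]\vdash\Delta$ infer $\Gamma,\exists xA\vdash\Delta$; $\exists_R$: from $\Gamma\vdash A[t/x]$ infer $\Gamma\vdash\exists xA$; $\forall_L$: from $\Gamma,A[t/x]\vdash\Delta$ infer $\Gamma,\forall xA\vdash\Delta$; $\forall_R$: from $\Gamma\vdash A[c/x]$ infer $\Gamma\vdash\forall xA$; left contraction; left weakening; right weakening (from $\Gamma\vdash$ infer $\Gamma\vdash A$); no cut. In $\forall_R,\exists_L$, $c$ is a fresh constant; in $\forall_L,\exists_R$, $t$ is any term. A focused sequent is $\Gamma\vdash S;\Delta$ where $\Gamma,\Delta$ are finite multisets and the stoup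 $S$ is either one formula $A$ (written $\Gamma\vdash A;\Delta$) or empty (written $\Gamma\vdash .;\Delta$). The focused classical sequent calculus has the rules: ax: $\Gamma,A\vdash .;A,\Delta$ with $A$ atomic; $\wedge_L$: from $\Gamma,A,B\vdash .;\Delta$ infer $\Gamma,A\wedge B\vdash .;\Delta$; $\wedge_R$: from $\Gamma\vdash A;\Delta$ and $\Gamma\vdash B;\Delta$ infer $\Gamma\vdash A\wedge B;\Delta$; $\vee_L$: from $\Gamma,A\vdash .;\Delta$ and $\Gamma,B\vdash .;\Delta$ infer $\Gamma,A\vee B\vdash .;\Delta$; $\vee_R$: from $\Gamma\vdash .;A,B,\Delta$ infer $\Gamma\vdash .;A\vee B,\Delta$; $\Rightarrow_L$: from $\Gamma\vdash A;\Delta$ and $\Gamma,B\vdash .;\Delta$ infer $\Gamma,A\Rightarrow B\vdash .;\Delta$; $\Rightarrow_R$: from $\Gamma,A\vdash B;\Delta$ infer $\Gamma\vdash A\Rightarrow B;\Delta$; $\neg_L$: from $\Gamma\vdash A;\Delta$ infer $\Gamma,\neg A\vdash .;\Delta$; $\neg_R$: from $\Gamma,A\vdash .;\Delta$ infer $\Gamma\vdash .;\neg A,\Delta$; $\exists_L$: from $\Gamma,A[c/x]\vdash .;\Delta$ infer $\Gamma,\exists xA\vdash .;\Delta$; $\exists_R$: from $\Gamma\vdash .;A[t/x],\Delta$ infer $\Gamma\vdash .;\exists xA,\Delta$; $\forall_L$: from $\Gamma,A[t/x]\vdash .;\Delta$ infer $\Gamma,\forall xA\vdash .;\Delta$; $\forall_R$: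 from $\Gamma\vdash A[c/x];\Delta$ infer $\Gamma\vdash\forall xA;\Delta$; contr$_L$: from $\Gamma,A,A\vdash .;\Delta$ infer $\Gamma,A\vdash .;\Delta$; contr$_R$: from $\Gamma\vdash .;A,A,\Delta$ infer $\Gamma\vdash .;A,\Delta$; weak$_L$: from $\Gamma\vdash .;\Delta$ infer $\Gamma,A\vdash .;\Delta$; weak$_R$: from $\Gamma\vdash .;\Delta$ infer $\Gamma\vdash A;\Delta$; focus: from $\Gamma\vdash A;\Delta$ infer $\Gamma\vdash .;A,\Delta$, provided $A$ is neither atomic nor of the form $\exists xB$, $B\vee C$, $\neg B$; release: from $\Gamma\vdash .;A,\Delta$ infer $\Gamma\vdash A;\Delta$, provided $A$ is atomic or of the form $\exists xB$, $B\vee C$ or $\neg B$. In $\forall_R$ and $\exists_L$, $c$ is a fresh constant; in $\forall_L$ and $\exists_R$, $t$ is any term. -}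

module Defs where

open import Data.Nat using (ℕ; zero; suc; _≡ᵇ_)
open import Data.Bool using (Bool; true; false; _∨_; _∧_; if_then_else_)
open import Data.List using (List; []; _∷_; map; _++_)
open import Data.List.Relation.Unary.All using (All)
open import Data.List.Relation.Binary.Permutation.Propositional using (_↭_)
open import Data.Maybe using (Maybe; just; nothing)
open import Relation.Binary.PropositionalEquality using (_≡_)
open import Relation.Nullary using (¬_)

-- First-order syntax (locally nameless).
-- bvar k : bound variable (de Bruijn index)
-- par c  : free variable / constant named c (eigenvariables are pars)
-- fun f ts : function symbol f applied to arguments ts

data Term : Set where
  bvar : ℕ → Term
  par  : ℕ → Term
  fun  : ℕ → List Term → Term

data Formula : Set where
  atom : ℕ → List Term → Formula
  _∧'_ : Formula → Formula → Formula
  _∨'_ : Formula → Formula → Formula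
  _⇒'_ : Formula → Formula → Formula
  ¬'_  : Formula → Formula
  ∀'   : Formula → Formula            -- binds bvar 0 in its body
  ∃'   : Formula → Formula            -- binds bvar 0 in its body

infixr 6 _∧'_
infixr 5 _∨'_
infixr 4 _⇒'_
infix 7 ¬'_

mutual
  closedT : Term → Bool
  closedT (bvar _)   = false
  closedT (par _)    = true
  closedT (fun _ ts) = closedTs ts

  closedTs : List Term → Bool
  closedTs []       = true
  closedTs (t ∷ ts) = closedT t ∧ closedTs ts

mutual
  openT : ℕ → Term → Term → Term
  openT k u (bvar i)   = if i ≡ᵇ k then u else bvar i
  openT k u (par c)    = par c
  openT k u (fun f ts) = fun f (openTs k u ts)

  openTs : ℕ → Term → List Term → List Term
  openTs k u []       = []
  openTs k u (t ∷ ts) = openT k u t ∷ openTs k u ts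

openF : ℕ → Term → Formula → Formula
openF k u (atom P ts) = atom P (openTs k u ts)
openF k u (A ∧' B)    = openF k u A ∧' openF k u B
openF k u (A ∨' B)    = openF k u A ∨' openF k u B
openF k u (A ⇒' B)    = openF k u A ⇒' openF k u B
openF k u (¬' A)      = ¬' openF k u A
openF k u (∀' A)      = ∀' (openF (suc k) u A)
openF k u (∃' A)      = ∃' (openF (suc k) u A)

-- A [ t /x ] for the body A of a quantifier ∀x A / ∃x A
_[_] : Formula → Term → Formula
A [ t ] = openF 0 t A

mutual
  occT : ℕ → Term → Bool
  occT c (bvar _)   = false
  occT c (par d)    = c ≡ᵇ d
  occT c (fun _ ts) = occTs c ts

  occTs : ℕ → List Term → Bool
  occTs c []       = false
  occTs c (t ∷ ts) = occT c t ∨ occTs c ts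

occF : ℕ → Formula → Bool
occF c (atom _ ts) = occTs c ts
occF c (A ∧' B)    = occF c A ∨ occF c B
occF c (A ∨' B)    = occF c A ∨ occF c B
occF c (A ⇒' B)    = occF c A ∨ occF c B
occF c (¬' A)      = occF c A
occF c (∀' A)      = occF c A
occF c (∃' A)      = occF c A

FreshL : ℕ → List Formula → Set
FreshL c Γ = All (λ A → occF c A ≡ false) Γ

FreshM : ℕ → Maybe Formula → Set
FreshM c nothing  = Data.Unit.⊤ where import Data.Unit
FreshM c (just A) = occF c A ≡ false

-- Antinegation and the polarized Gödel–Gentzen translations

antineg : Formula → Formula
antineg (¬' B) = B
antineg A      = ¬' A

mutual
  _ᵖ : Formula → Formula
  (atom P ts) ᵖ = atom P ts
  (A ∧' B) ᵖ    = A ᵖ ∧' B ᵖ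
  (A ∨' B) ᵖ    = A ᵖ ∨' B ᵖ
  (A ⇒' B) ᵖ    = A ⁿ ⇒' B ᵖ
  (¬' A) ᵖ      = ¬' (A ⁿ)
  (∀' A) ᵖ      = ∀' (A ᵖ)
  (∃' A) ᵖ      = ∃' (A ᵖ)

  _ⁿ : Formula → Formula
  (atom P ts) ⁿ = ¬' ¬' atom P ts
  (A ∧' B) ⁿ    = A ⁿ ∧' B ⁿ
  (A ∨' B) ⁿ    = ¬' (¬' (A ⁿ) ∧' ¬' (B ⁿ))
  (A ⇒' B) ⁿ    = A ᵖ ⇒' B ⁿ
  (¬' A) ⁿ      = ¬' (A ᵖ)
  (∀' A) ⁿ      = ∀' (A ⁿ)
  (∃' A) ⁿ      = ¬' ∀' (¬' (A ⁿ))

infix 9 _ᵖ _ⁿ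

_ⁿ? : Maybe Formula → Maybe Formula
nothing ⁿ?  = nothing
(just A) ⁿ? = just (A ⁿ)

-- Cut-free intuitionistic sequent calculus  Γ ⊢ Δ,  Δ at most one formula.
-- Contexts are multisets, represented as lists modulo the exchange rule.

infix 3 _⊢ᵢ_

data _⊢ᵢ_ : List Formula → Maybe Formula → Set where
  exch  : ∀ {Γ Γ' Δ} → Γ ↭ Γ' → Γ ⊢ᵢ Δ → Γ' ⊢ᵢ Δ
  ax    : ∀ {Γ A} → A ∷ Γ ⊢ᵢ just A
  ∧L    : ∀ {Γ A B Δ} → A ∷ B ∷ Γ ⊢ᵢ Δ → (A ∧' B) ∷ Γ ⊢ᵢ Δ
  ∧R    : ∀ {Γ A B} → Γ ⊢ᵢ just A → Γ ⊢ᵢ just B → Γ ⊢ᵢ just (A ∧' B)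
  ∨L    : ∀ {Γ A B Δ} → A ∷ Γ ⊢ᵢ Δ → B ∷ Γ ⊢ᵢ Δ → (A ∨' B) ∷ Γ ⊢ᵢ Δ
  ∨R1   : ∀ {Γ A B} → Γ ⊢ᵢ just A → Γ ⊢ᵢ just (A ∨' B)
  ∨R2   : ∀ {Γ A B} → Γ ⊢ᵢ just B → Γ ⊢ᵢ just (A ∨' B)
  ⇒L    : ∀ {Γ A B Δ} → Γ ⊢ᵢ just A → B ∷ Γ ⊢ᵢ Δ → (A ⇒' B) ∷ Γ ⊢ᵢ Δ
  ⇒R    : ∀ {Γ A B} → A ∷ Γ ⊢ᵢ just B → Γ ⊢ᵢ just (A ⇒' B)
  ¬L    : ∀ {Γ A Δ} → Γ ⊢ᵢ just A → (¬' A) ∷ Γ ⊢ᵢ Δ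
  ¬R    : ∀ {Γ A} → A ∷ Γ ⊢ᵢ nothing → Γ ⊢ᵢ just (¬' A)
  ∃L    : ∀ {Γ A Δ} (c : ℕ) → FreshL c Γ → occF c A ≡ false → FreshM c Δ →
          A [ par c ] ∷ Γ ⊢ᵢ Δ → ∃' A ∷ Γ ⊢ᵢ Δ
  ∃R    : ∀ {Γ A} (t : Term) → closedT t ≡ true →
          Γ ⊢ᵢ just (A [ t ]) → Γ ⊢ᵢ just (∃' A)
  ∀L    : ∀ {Γ A Δ} (t : Term) → closedT t ≡ true →
          A [ t ] ∷ Γ ⊢ᵢ Δ → ∀' A ∷ Γ ⊢ᵢ Δ
  ∀R    : ∀ {Γ A} (c : ℕ) → FreshL c Γ → occF c A ≡ false →
          Γ ⊢ᵢ just (A [ par c ]) → Γ ⊢ᵢ just (∀' A)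
  contrL : ∀ {Γ A Δ} → A ∷ A ∷ Γ ⊢ᵢ Δ → A ∷ Γ ⊢ᵢ Δ
  weakL  : ∀ {Γ A Δ} → Γ ⊢ᵢ Δ → A ∷ Γ ⊢ᵢ Δ
  weakR  : ∀ {Γ A} → Γ ⊢ᵢ nothing → Γ ⊢ᵢ just A

-- Focused classical sequent calculus  Γ ⊢ S ; Δ  (S the stoup, possibly empty)

data Releasable : Formula → Set where
  r-atom : ∀ {P ts} → Releasable (atom P ts)
  r-∃    : ∀ {A} → Releasable (∃' A)
  r-∨    : ∀ {A B} → Releasable (A ∨' B)
  r-¬    : ∀ {A} → Releasable (¬' A)

data Atomic : Formula → Set where
  is-atom : ∀ {P ts} → Atomic (atom P ts)

infix 3 _⊢f_⨾_

data _⊢f_⨾_ : List Formula → Maybe Formula → List Formula → Set where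
  exch   : ∀ {Γ Γ' S Δ Δ'} → Γ ↭ Γ' → Δ ↭ Δ' → Γ ⊢f S ⨾ Δ → Γ' ⊢f S ⨾ Δ'
  ax     : ∀ {Γ A Δ} → Atomic A → A ∷ Γ ⊢f nothing ⨾ A ∷ Δ
  ∧L     : ∀ {Γ A B Δ} → A ∷ B ∷ Γ ⊢f nothing ⨾ Δ → (A ∧' B) ∷ Γ ⊢f nothing ⨾ Δ
  ∧R     : ∀ {Γ A B Δ} → Γ ⊢f just A ⨾ Δ → Γ ⊢f just B ⨾ Δ → Γ ⊢f just (A ∧' B) ⨾ Δ
  ∨L     : ∀ {Γ A B Δ} → A ∷ Γ ⊢f nothing ⨾ Δ → B ∷ Γ ⊢f nothing ⨾ Δ →
           (A ∨' B) ∷ Γ ⊢f nothing ⨾ Δ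
  ∨R     : ∀ {Γ A B Δ} → Γ ⊢f nothing ⨾ A ∷ B ∷ Δ → Γ ⊢f nothing ⨾ (A ∨' B) ∷ Δ
  ⇒L     : ∀ {Γ A B Δ} → Γ ⊢f just A ⨾ Δ → B ∷ Γ ⊢f nothing ⨾ Δ →
           (A ⇒' B) ∷ Γ ⊢f nothing ⨾ Δ
  ⇒R     : ∀ {Γ A B Δ} → A ∷ Γ ⊢f just B ⨾ Δ → Γ ⊢f just (A ⇒' B) ⨾ Δ
  ¬L     : ∀ {Γ A Δ} → Γ ⊢f just A ⨾ Δ → (¬' A) ∷ Γ ⊢f nothing ⨾ Δ
  ¬R     : ∀ {Γ A Δ} → A ∷ Γ ⊢f nothing ⨾ Δ → Γ ⊢f nothing ⨾ (¬' A) ∷ Δ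
  ∃L     : ∀ {Γ A Δ} (c : ℕ) → FreshL c Γ → occF c A ≡ false → FreshL c Δ →
           A [ par c ] ∷ Γ ⊢f nothing ⨾ Δ → ∃' A ∷ Γ ⊢f nothing ⨾ Δ
  ∃R     : ∀ {Γ A Δ} (t : Term) → closedT t ≡ true →
           Γ ⊢f nothing ⨾ (A [ t ]) ∷ Δ → Γ ⊢f nothing ⨾ (∃' A) ∷ Δ
  ∀L     : ∀ {Γ A Δ} (t : Term) → closedT t ≡ true →
           A [ t ] ∷ Γ ⊢f nothing ⨾ Δ → ∀' A ∷ Γ ⊢f nothing ⨾ Δ
  ∀R     : ∀ {Γ A Δ} (c : ℕ) → FreshL c Γ → occF c A ≡ false → FreshL c Δ →
           Γ ⊢f just (A [ par c ]) ⨾ Δ → Γ ⊢f just (∀' A) ⨾ Δ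
  contrL : ∀ {Γ A Δ} → A ∷ A ∷ Γ ⊢f nothing ⨾ Δ → A ∷ Γ ⊢f nothing ⨾ Δ
  contrR : ∀ {Γ A Δ} → Γ ⊢f nothing ⨾ A ∷ A ∷ Δ → Γ ⊢f nothing ⨾ A ∷ Δ
  weakL  : ∀ {Γ A Δ} → Γ ⊢f nothing ⨾ Δ → A ∷ Γ ⊢f nothing ⨾ Δ
  weakR  : ∀ {Γ A Δ} → Γ ⊢f nothing ⨾ Δ → Γ ⊢f just A ⨾ Δ
  focus  : ∀ {Γ A Δ} → ¬ Releasable A → Γ ⊢f just A ⨾ Δ → Γ ⊢f nothing ⨾ A ∷ Δ
  release : ∀ {Γ A Δ} → Releasable A → Γ ⊢f nothing ⨾ A ∷ Δ → Γ ⊢f just A ⨾ Δ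

module Submission where

-- Read the translated sequent  Γᵖ, ⌟Δⁿ ⊢ Sⁿ  as follows: a formula
-- B on the classical right-hand side Δ becomes the hypothesis ⌟(Bⁿ), i.e. "Bⁿ is
-- refuted".  The theorem is then proved by induction on the focused derivation,
-- showing that every focused rule is admissible on the translated side:
--   * left rules and rules acting on the stoup translate into the same
--     intuitionistic rule, since ᵖ resp. ⁿ commute with the connective at hand;
--   * a rule acting on a formula B of Δ becomes a LEFT rule acting on ⌟(Bⁿ).
--     This uses that ¬X is derivable on the left whenever ⌟X is (antineg is a
--     "shortcut" negation), and that for releasable B the formula Bⁿ is itself
--     the negation ¬⌟(Bⁿ), while for non-releasable B, ⌟(Bⁿ) is ¬(Bⁿ).

open import Defs
open import Data.List using (List; _∷_; map; _++_)
open import Data.Maybe using (Maybe; just; nothing)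
open import Data.Bool using (true; false; _∨_)
open import Data.Empty using (⊥-elim)
open import Relation.Nullary using (¬_)
open import Relation.Binary.PropositionalEquality using (_≡_; refl; cong; cong₂; trans; sym; subst)
open import Data.List.Relation.Binary.Permutation.Propositional using (_↭_; ↭-sym)
import Data.List.Relation.Binary.Permutation.Propositional.Properties as Perm
import Data.List.Relation.Unary.All as All
import Data.List.Relation.Unary.All.Properties as AllP

mutual
  open-ᵖ : ∀ k u A → openF k u (A ᵖ) ≡ (openF k u A) ᵖ
  open-ᵖ k u (atom P ts) = refl
  open-ᵖ k u (A ∧' B)    = cong₂ _∧'_ (open-ᵖ k u A) (open-ᵖ k u B)
  open-ᵖ k u (A ∨' B)    = cong₂ _∨'_ (open-ᵖ k u A) (open-ᵖ k u B)
  open-ᵖ k u (A ⇒' B)    = cong₂ _⇒'_ (open-ⁿ k u A) (open-ᵖ k u B)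
  open-ᵖ k u (¬' A)      = cong ¬'_ (open-ⁿ k u A)
  open-ᵖ k u (∀' A)      = cong ∀' (open-ᵖ _ u A)
  open-ᵖ k u (∃' A)      = cong ∃' (open-ᵖ _ u A)

  open-ⁿ : ∀ k u A → openF k u (A ⁿ) ≡ (openF k u A) ⁿ
  open-ⁿ k u (atom P ts) = refl
  open-ⁿ k u (A ∧' B)    = cong₂ _∧'_ (open-ⁿ k u A) (open-ⁿ k u B)
  open-ⁿ k u (A ∨' B)    = cong₂ (λ X Y → ¬' (¬' X ∧' ¬' Y)) (open-ⁿ k u A) (open-ⁿ k u B)
  open-ⁿ k u (A ⇒' B)    = cong₂ _⇒'_ (open-ᵖ k u A) (open-ⁿ k u B)
  open-ⁿ k u (¬' A)      = cong ¬'_ (open-ᵖ k u A)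
  open-ⁿ k u (∀' A)      = cong ∀' (open-ⁿ _ u A)
  open-ⁿ k u (∃' A)      = cong (λ X → ¬' ∀' (¬' X)) (open-ⁿ _ u A)

-- The translations add no constants, so eigenvariable conditions survive them.
mutual
  occ-ᵖ : ∀ c A → occF c (A ᵖ) ≡ occF c A
  occ-ᵖ c (atom P ts) = refl
  occ-ᵖ c (A ∧' B)    = cong₂ _∨_ (occ-ᵖ c A) (occ-ᵖ c B)
  occ-ᵖ c (A ∨' B)    = cong₂ _∨_ (occ-ᵖ c A) (occ-ᵖ c B)
  occ-ᵖ c (A ⇒' B)    = cong₂ _∨_ (occ-ⁿ c A) (occ-ᵖ c B)
  occ-ᵖ c (¬' A)      = occ-ⁿ c A
  occ-ᵖ c (∀' A)      = occ-ᵖ c A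
  occ-ᵖ c (∃' A)      = occ-ᵖ c A

  occ-ⁿ : ∀ c A → occF c (A ⁿ) ≡ occF c A
  occ-ⁿ c (atom P ts) = refl
  occ-ⁿ c (A ∧' B)    = cong₂ _∨_ (occ-ⁿ c A) (occ-ⁿ c B)
  occ-ⁿ c (A ∨' B)    = cong₂ _∨_ (occ-ⁿ c A) (occ-ⁿ c B)
  occ-ⁿ c (A ⇒' B)    = cong₂ _∨_ (occ-ᵖ c A) (occ-ⁿ c B)
  occ-ⁿ c (¬' A)      = occ-ᵖ c A
  occ-ⁿ c (∀' A)      = occ-ⁿ c A
  occ-ⁿ c (∃' A)      = occ-ⁿ c A

occ-antineg : ∀ c X → occF c (antineg X) ≡ occF c X
occ-antineg c (atom P ts) = refl
occ-antineg c (X ∧' Y)    = refl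
occ-antineg c (X ∨' Y)    = refl
occ-antineg c (X ⇒' Y)    = refl
occ-antineg c (¬' X)      = refl
occ-antineg c (∀' X)      = refl
occ-antineg c (∃' X)      = refl

-- The hypothesis contributed by a formula B of the classical right-hand side.
⌟ⁿ : Formula → Formula
⌟ⁿ B = antineg (B ⁿ)

⟪_∣_⟫ : List Formula → List Formula → List Formula
⟪ Γ ∣ Δ ⟫ = map _ᵖ Γ ++ map ⌟ⁿ Δ

fresh-⟪⟫ : ∀ {c} Γ Δ → FreshL c Γ → FreshL c Δ → FreshL c ⟪ Γ ∣ Δ ⟫
fresh-⟪⟫ {c} Γ Δ freshΓ freshΔ =
  AllP.++⁺ (AllP.map⁺ (All.map (λ {A} e → trans (occ-ᵖ c A) e) freshΓ))
           (AllP.map⁺ (All.map (λ {A} e → trans (occ-antineg c (A ⁿ)) (trans (occ-ⁿ c A) e)) freshΔ))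

⟪⟫-↭ : ∀ {Γ Γ' Δ Δ'} → Γ ↭ Γ' → Δ ↭ Δ' → ⟪ Γ ∣ Δ ⟫ ↭ ⟪ Γ' ∣ Δ' ⟫
⟪⟫-↭ Γ↭Γ' Δ↭Δ' = Perm.++⁺ (Perm.map⁺ _ᵖ Γ↭Γ') (Perm.map⁺ ⌟ⁿ Δ↭Δ')

-- The hypothesis coming from the head of Δ may be moved to the front, so that
-- intuitionistic left rules can act on it.
⟪⟫-head : ∀ Γ X Δ → ⟪ Γ ∣ X ∷ Δ ⟫ ↭ ⌟ⁿ X ∷ ⟪ Γ ∣ Δ ⟫
⟪⟫-head Γ X Δ = Perm.shift (⌟ⁿ X) (map _ᵖ Γ) (map ⌟ⁿ Δ)

toFront : ∀ {Γ X Δ S} → ⟪ Γ ∣ X ∷ Δ ⟫ ⊢ᵢ S → ⌟ⁿ X ∷ ⟪ Γ ∣ Δ ⟫ ⊢ᵢ S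
toFront {Γ} {X} {Δ} d = exch (⟪⟫-head Γ X Δ) d

fromFront : ∀ {Γ X Δ S} → ⌟ⁿ X ∷ ⟪ Γ ∣ Δ ⟫ ⊢ᵢ S → ⟪ Γ ∣ X ∷ Δ ⟫ ⊢ᵢ S
fromFront {Γ} {X} {Δ} d = exch (↭-sym (⟪⟫-head Γ X Δ)) d

toFront₂ : ∀ {Γ X Y Δ S} → ⟪ Γ ∣ X ∷ Y ∷ Δ ⟫ ⊢ᵢ S → ⌟ⁿ X ∷ ⌟ⁿ Y ∷ ⟪ Γ ∣ Δ ⟫ ⊢ᵢ S
toFront₂ {Γ} {X} {Y} {Δ} d = exch (_↭_.prep (⌟ⁿ X) (⟪⟫-head Γ Y Δ)) (toFront {Γ} {X} {Y ∷ Δ} d)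

swapL : ∀ {Γ A B S} → A ∷ B ∷ Γ ⊢ᵢ S → B ∷ A ∷ Γ ⊢ᵢ S
swapL d = exch (_↭_.swap _ _ _↭_.refl) d

-- ⌟X is at least as strong a hypothesis as ¬X: refuting Γ, ⌟X refutes Γ, ¬X.
-- (Only for X = ¬Y is there work to do: ¬¬Y refutes whatever Y refutes.)
antineg⇒¬ : ∀ {Γ} X → antineg X ∷ Γ ⊢ᵢ nothing → ¬' X ∷ Γ ⊢ᵢ nothing
antineg⇒¬ (atom P ts) d = d
antineg⇒¬ (X ∧' Y)    d = d
antineg⇒¬ (X ∨' Y)    d = d
antineg⇒¬ (X ⇒' Y)    d = d
antineg⇒¬ (¬' X)      d = ¬L (¬R d)
antineg⇒¬ (∀' X)      d = d
antineg⇒¬ (∃' X)      d = d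

releasable-ⁿ : ∀ {A} → Releasable A → A ⁿ ≡ ¬' ⌟ⁿ A
releasable-ⁿ r-atom = refl
releasable-ⁿ r-∃    = refl
releasable-ⁿ r-∨    = refl
releasable-ⁿ r-¬    = refl

-- For a non-releasable formula, Aⁿ is not a negation, so ⌟(Aⁿ) = ¬(Aⁿ).
focusable-⌟ⁿ : ∀ A → ¬ Releasable A → ⌟ⁿ A ≡ ¬' (A ⁿ)
focusable-⌟ⁿ (atom P ts) nr = ⊥-elim (nr r-atom)
focusable-⌟ⁿ (A ∧' B)    nr = refl
focusable-⌟ⁿ (A ∨' B)    nr = ⊥-elim (nr r-∨)
focusable-⌟ⁿ (A ⇒' B)    nr = refl
focusable-⌟ⁿ (¬' A)      nr = ⊥-elim (nr r-¬)
focusable-⌟ⁿ (∀' A)      nr = refl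
focusable-⌟ⁿ (∃' A)      nr = ⊥-elim (nr r-∃)

-- Axiom: for atomic A, ⌟(Aⁿ) = ⌟(¬¬A) = ¬A, refuted by the hypothesis Aᵖ = A.
axiom-tr : ∀ {Γ A Δ} → Atomic A → ⟪ A ∷ Γ ∣ A ∷ Δ ⟫ ⊢ᵢ nothing
axiom-tr {Γ} {A} {Δ} is-atom = fromFront {A ∷ Γ} {A} {Δ} (¬L ax)

-- ∨R: the hypothesis ¬Aⁿ ∧ ¬Bⁿ is split, each conjunct replacing ⌟(Aⁿ), ⌟(Bⁿ).
∨R-tr : ∀ {Γ A B Δ} → ⟪ Γ ∣ A ∷ B ∷ Δ ⟫ ⊢ᵢ nothing → ⟪ Γ ∣ (A ∨' B) ∷ Δ ⟫ ⊢ᵢ nothing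
∨R-tr {Γ} {A} {B} {Δ} d = fromFront {Γ} {A ∨' B} {Δ} (∧L negA,negB)
  where
    negA,⌟B : ¬' (A ⁿ) ∷ ⌟ⁿ B ∷ ⟪ Γ ∣ Δ ⟫ ⊢ᵢ nothing
    negA,⌟B = antineg⇒¬ (A ⁿ) (toFront₂ {Γ} {A} {B} {Δ} d)

    negA,negB : ¬' (A ⁿ) ∷ ¬' (B ⁿ) ∷ ⟪ Γ ∣ Δ ⟫ ⊢ᵢ nothing
    negA,negB = swapL (antineg⇒¬ (B ⁿ) (swapL negA,⌟B))

-- ∃R: the hypothesis ∀x¬Aⁿ is instantiated at t, giving ¬(A[t])ⁿ.
∃R-tr : ∀ {Γ A Δ} t → closedT t ≡ true →
        ⟪ Γ ∣ A [ t ] ∷ Δ ⟫ ⊢ᵢ nothing → ⟪ Γ ∣ ∃' A ∷ Δ ⟫ ⊢ᵢ nothing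
∃R-tr {Γ} {A} {Δ} t closed d =
  fromFront {Γ} {∃' A} {Δ} (∀L t closed
    (subst (λ X → ¬' X ∷ ⟪ Γ ∣ Δ ⟫ ⊢ᵢ nothing) (sym (open-ⁿ 0 t A))
      (antineg⇒¬ ((A [ t ]) ⁿ) (toFront {Γ} {A [ t ]} {Δ} d))))

-- Right contraction becomes left contraction on ⌟(Aⁿ).
contrR-tr : ∀ {Γ A Δ} → ⟪ Γ ∣ A ∷ A ∷ Δ ⟫ ⊢ᵢ nothing → ⟪ Γ ∣ A ∷ Δ ⟫ ⊢ᵢ nothing
contrR-tr {Γ} {A} {Δ} d = fromFront {Γ} {A} {Δ} (contrL (toFront₂ {Γ} {A} {A} {Δ} d))

-- focus: the hypothesis ¬(Aⁿ) is used against the translated stoup Aⁿ.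
focus-tr : ∀ {Γ A Δ} → ¬ Releasable A →
           ⟪ Γ ∣ Δ ⟫ ⊢ᵢ just (A ⁿ) → ⟪ Γ ∣ A ∷ Δ ⟫ ⊢ᵢ nothing
focus-tr {Γ} {A} {Δ} nr d =
  fromFront {Γ} {A} {Δ} (subst (λ X → X ∷ ⟪ Γ ∣ Δ ⟫ ⊢ᵢ nothing) (sym (focusable-⌟ⁿ A nr)) (¬L d))

-- release: Aⁿ = ¬⌟(Aⁿ) is proved by refuting the hypothesis ⌟(Aⁿ).
release-tr : ∀ {Γ A Δ} → Releasable A →
             ⟪ Γ ∣ A ∷ Δ ⟫ ⊢ᵢ nothing → ⟪ Γ ∣ Δ ⟫ ⊢ᵢ just (A ⁿ)
release-tr {Γ} {A} {Δ} r d =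
  subst (λ X → ⟪ Γ ∣ Δ ⟫ ⊢ᵢ just X) (sym (releasable-ⁿ r)) (¬R (toFront {Γ} {A} {Δ} d))

-- The quantifier rules on Γ and on the stoup are the intuitionistic ones, up to
-- commuting the translation with substitution and transporting freshness.
∃L-tr : ∀ {Γ A Δ} c → FreshL c Γ → occF c A ≡ false → FreshL c Δ →
        ⟪ A [ par c ] ∷ Γ ∣ Δ ⟫ ⊢ᵢ nothing → ⟪ ∃' A ∷ Γ ∣ Δ ⟫ ⊢ᵢ nothing
∃L-tr {Γ} {A} {Δ} c freshΓ freshA freshΔ d =
  ∃L c (fresh-⟪⟫ Γ Δ freshΓ freshΔ) (trans (occ-ᵖ c A) freshA) _
     (subst (λ X → X ∷ ⟪ Γ ∣ Δ ⟫ ⊢ᵢ nothing) (sym (open-ᵖ 0 (par c) A)) d)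

∀L-tr : ∀ {Γ A Δ} t → closedT t ≡ true →
        ⟪ A [ t ] ∷ Γ ∣ Δ ⟫ ⊢ᵢ nothing → ⟪ ∀' A ∷ Γ ∣ Δ ⟫ ⊢ᵢ nothing
∀L-tr {Γ} {A} {Δ} t closed d =
  ∀L t closed (subst (λ X → X ∷ ⟪ Γ ∣ Δ ⟫ ⊢ᵢ nothing) (sym (open-ᵖ 0 t A)) d)

∀R-tr : ∀ {Γ A Δ} c → FreshL c Γ → occF c A ≡ false → FreshL c Δ →
        ⟪ Γ ∣ Δ ⟫ ⊢ᵢ just ((A [ par c ]) ⁿ) → ⟪ Γ ∣ Δ ⟫ ⊢ᵢ just ((∀' A) ⁿ)
∀R-tr {Γ} {A} {Δ} c freshΓ freshA freshΔ d =
  ∀R c (fresh-⟪⟫ Γ Δ freshΓ freshΔ) (trans (occ-ⁿ c A) freshA)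
     (subst (λ X → ⟪ Γ ∣ Δ ⟫ ⊢ᵢ just X) (sym (open-ⁿ 0 (par c) A)) d)

translate : ∀ {Γ S Δ} → Γ ⊢f S ⨾ Δ → ⟪ Γ ∣ Δ ⟫ ⊢ᵢ S ⁿ?
translate (exch Γ↭Γ' Δ↭Δ' d) = exch (⟪⟫-↭ Γ↭Γ' Δ↭Δ') (translate d)
translate (ax atomic)         = axiom-tr atomic
translate (∧L d)              = ∧L (translate d)
translate (∧R d e)            = ∧R (translate d) (translate e)
translate (∨L d e)            = ∨L (translate d) (translate e)
translate (∨R d)              = ∨R-tr (translate d)
translate (⇒L d e)            = ⇒L (translate d) (translate e)
translate (⇒R d)              = ⇒R (translate d)
translate (¬L d)              = ¬L (translate d)
translate (∃L c fΓ fA fΔ d)   = ∃L-tr c fΓ fA fΔ (translate d)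
translate (∃R t closed d)     = ∃R-tr t closed (translate d)
translate (contrL d)          = contrL (translate d)
translate (weakL d)           = weakL (translate d)
translate (weakR d)           = weakR (translate d)
translate {Γ} {Δ = ¬' A ∷ Δ} (¬R d) =
  fromFront {Γ} {¬' A} {Δ} (translate d)
translate {∀' A ∷ Γ} {Δ = Δ} (∀L t closed d) =
  ∀L-tr {Γ} {A} {Δ} t closed (translate d)
translate {Γ} {Δ = Δ} (∀R {A = A} c fΓ fA fΔ d) =
  ∀R-tr {Γ} {A} {Δ} c fΓ fA fΔ (translate d)
translate {Γ} {Δ = A ∷ Δ} (contrR d) =
  contrR-tr {Γ} {A} {Δ} (translate d)
translate {Γ} {Δ = A ∷ Δ} (focus nr d) =
  focus-tr {Γ} {A} {Δ} nr (translate d)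
translate {Γ} {just A} {Δ} (release r d) =
  release-tr {Γ} {A} {Δ} r (translate d)

theorem3 : (Γ : List Formula) (S : Maybe Formula) (Δ : List Formula) →
           Γ ⊢f S ⨾ Δ →
           map _ᵖ Γ ++ map (λ B → antineg (B ⁿ)) Δ ⊢ᵢ S ⁿ?
theorem3 Γ S Δ = translate
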